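{- Let $H$ be a hypergraph and $B\subseteq V(H)$. Then $B$ is a lazy burning set for $H$ if and only if the hypergraph $H\setminus B$ is degenerate.
   Context: A hypergraph $H$ consists of a finite vertex set $V(H)$ and a finite collection $E(H)$ of nonempty subsets of $V(H)$. Lazy burning: a set $B\subseteq V(H)$ is burned initially; in each subsequent round every unburned vertex $v$ for which some hyperedge $h\ni v$ has $h\setminus\{v\}$ entirely burned becomes burned (so vertices of singleton hyperedges burn immediately). $B$ is a lazy burning set if eventually all vertices burn. For $U\subseteq V(H)$, the (weakly) induced subhypergraph $H[U]$ has vertex set $U$ and hyperedges $\{h\cap U: h\in E(H),\ h\cap U\neq\emptyset\}$; $H\setminus U:=H[V(H)\setminus U]$. The core $\mathrm{core}(H)$ is the induced subhypergraph $H[U]$ for the largest $U\subseteq V(H)$ such that every hyperedge of $H[U]$ has cardinality at least $2$ (equivalently, the result of repeatedly deleting the vertex of a singleton hyperedge until none remain). $H$ is degenerate if $\mathrm{core}(H)$ has no vertices. -}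

module Defs where

open import Data.Nat using (ℕ; zero; suc; _≤_)
open import Data.Fin using (Fin)
open import Data.Fin.Subset using (Subset; _∈_; _⊆_; _∩_; _─_; ∣_∣; Nonempty; Empty)
open import Data.Fin.Subset.Properties using (nonempty?)
open import Data.List using (List; map; filter)
open import Data.List.Relation.Unary.All using (All)
import Data.List.Membership.Propositional as LM
open import Data.Product using (Σ; ∃; _×_)
open import Data.Sum using (_⊎_)
open import Relation.Binary.PropositionalEquality using (_≢_)

-- A hypergraph whose vertices are drawn from the finite ground set Fin n:
-- vertex set V ⊆ Fin n and a finite collection (list, repetitions allowed) of hyperedges.
record Hypergraph (n : ℕ) : Set where
  constructor hypergraph
  field
    V : Subset n
    E : List (Subset n)
open Hypergraph public

WellFormed : ∀ {n} → Hypergraph n → Set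
WellFormed H = All (λ h → Nonempty h × h ⊆ V H) (E H)

-- Lazy burning: the set of vertices burned after k rounds, starting from B.
Burned : ∀ {n} → Hypergraph n → Subset n → ℕ → Fin n → Set
Burned         H B zero    v = v ∈ B
Burned {n = n} H B (suc k) v =
  Burned H B k v
  ⊎ Σ (Subset n) (λ h → h LM.∈ E H × v ∈ h × (∀ w → w ∈ h → w ≢ v → Burned H B k w))

IsLazyBurningSet : ∀ {n} → Hypergraph n → Subset n → Set
IsLazyBurningSet H B = ∃ λ k → ∀ v → v ∈ V H → Burned H B k v

induced : ∀ {n} → Hypergraph n → Subset n → Hypergraph n
induced H U = hypergraph U (filter nonempty? (map (_∩ U) (E H)))

_∖_ : ∀ {n} → Hypergraph n → Subset n → Hypergraph n
H ∖ U = induced H (V H ─ U)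

AllEdgesAtLeast2 : ∀ {n} → Hypergraph n → Set
AllEdgesAtLeast2 H = All (λ h → 2 ≤ ∣ h ∣) (E H)

IsCoreSet : ∀ {n} → Hypergraph n → Subset n → Set
IsCoreSet H U =
  U ⊆ V H × AllEdgesAtLeast2 (induced H U)
  × (∀ U′ → U′ ⊆ V H → AllEdgesAtLeast2 (induced H U′) → U′ ⊆ U)

Degenerate : ∀ {n} → Hypergraph n → Set
Degenerate H = ∃ λ U → IsCoreSet H U × Empty (V (induced H U))

-- A vertex can only burn through a hyperedge in which every other vertex is
-- already burned.  Hence if every hyperedge of (H ∖ B)[U] has two vertices,
-- no vertex of U ever burns: each would need an earlier burned neighbour in U.
-- Conversely, while some vertex is unburned, the unburned vertices U form a
-- nonempty subset of V(H) ∖ B, so if H ∖ B is degenerate some hyperedge of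
-- (H ∖ B)[U] is a singleton {v}; all other vertices of its hyperedge are burned,
-- so v burns in the next round.  The unburned set thus shrinks every round
-- until it is empty.
module Submission where

open import Defs
open import Data.Nat using (ℕ; zero; suc; _+_; _≤_; _<_; z≤n; s≤s; _≤?_)
open import Data.Nat.Properties
  using (≤-trans; ≤-<-trans; <-≤-trans; <⇒≱; n≮n; +-suc; +-monoʳ-≤; m<m+n; module ≤-Reasoning)
open import Data.Fin using (Fin; _≟_)
open import Data.Fin.Properties using (all?)
open import Data.Fin.Subset
  using (Subset; _∈_; _∉_; _⊆_; _∩_; _─_; _-_; ∣_∣; Nonempty; Empty; ⁅_⁆; ⊥; outside)
open import Data.Fin.Subset.Properties
  using ( _∈?_; nonempty?; Empty-unique; ∣⊥∣≡0; ∣p∣≤n; ∉⊥; ⊆-min; x∈⁅x⁆; x∈⁅y⁆⇒x≡y; ∣⁅x⁆∣≡1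
        ; p⊆q⇒∣p∣≤∣q∣; x∈p∩q⁺; x∈p∩q⁻; p─q⊆p; x∈p∧x∉q⇒x∈p─q; x∈p∧x≢y⇒x∈p-y
        ; x∈p⇒∣p-x∣<∣p∣)
open import Data.Vec using (_∷_; here; there; tabulate)
open import Data.Vec.Properties using (lookup⇒[]=; []=⇒lookup; lookup∘tabulate)
open import Data.List.Relation.Unary.All as All using (All)
open import Data.List.Relation.Unary.All.Properties using (¬All⇒Any¬)
open import Data.List.Relation.Unary.Any using (any?)
import Data.List.Membership.Propositional as List
open import Data.List.Membership.Propositional.Properties
  using (∈-map⁺; ∈-map⁻; ∈-filter⁺; ∈-filter⁻)
open import Data.Product using (∃; _×_; _,_; proj₁; proj₂)
open import Data.Sum using (inj₁; inj₂)
open import Data.Empty using (⊥-elim)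
open import Function using (_∘_)
open import Function.Bundles using (_⇔_; mk⇔)
import Function.Properties.Equivalence as ⇔
open import Relation.Nullary using (yes; no; ¬_; ¬?; does)
open import Relation.Nullary.Decidable
  using (_×-dec_; _⊎-dec_; _→-dec_; map′; dec-true; decidable-stable)
open import Level using (0ℓ)
open import Relation.Unary using (Pred; Decidable)
open import Relation.Binary.PropositionalEquality using (_≡_; _≢_; refl; sym; trans; subst; cong)

x∈p─q⇒x∉q : ∀ {n} {x : Fin n} (p q : Subset n) → x ∈ p ─ q → x ∉ q
x∈p─q⇒x∉q (_ ∷ p) (outside ∷ q) here      ()
x∈p─q⇒x∉q (_ ∷ p) (_ ∷ q)       (there x∈) (there x∈q) = x∈p─q⇒x∉q p q x∈ x∈q

module _ {n : ℕ} where

  x∈p⇒0<∣p∣ : ∀ {x : Fin n} {p : Subset n} → x ∈ p → 0 < ∣ p ∣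
  x∈p⇒0<∣p∣ {x} {p} x∈p = subst (_≤ ∣ p ∣) (∣⁅x⁆∣≡1 x) (p⊆q⇒∣p∣≤∣q∣ ⁅x⁆⊆p)
    where
    ⁅x⁆⊆p : ⁅ x ⁆ ⊆ p
    ⁅x⁆⊆p y∈⁅x⁆ = subst (_∈ p) (sym (x∈⁅y⁆⇒x≡y x y∈⁅x⁆)) x∈p

  0<∣p∣⇒Nonempty : ∀ {p : Subset n} → 0 < ∣ p ∣ → Nonempty p
  0<∣p∣⇒Nonempty {p} 0<∣p∣ with nonempty? p
  ... | yes p≢∅ = p≢∅
  ... | no  p≡∅ = ⊥-elim (n≮n 0 (subst (0 <_) ∣p∣≡0 0<∣p∣))
    where
    ∣p∣≡0 : ∣ p ∣ ≡ 0
    ∣p∣≡0 = trans (cong ∣_∣ (Empty-unique p≡∅)) (∣⊥∣≡0 n)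

  x∈p∧y∈p∧x≢y⇒2≤∣p∣ : ∀ {x y : Fin n} {p : Subset n} →
                       x ∈ p → y ∈ p → x ≢ y → 2 ≤ ∣ p ∣
  x∈p∧y∈p∧x≢y⇒2≤∣p∣ x∈p y∈p x≢y =
    ≤-trans (s≤s (x∈p⇒0<∣p∣ (x∈p∧x≢y⇒x∈p-y y∈p (x≢y ∘ sym)))) (x∈p⇒∣p-x∣<∣p∣ x∈p)

  p⊆⁅x⁆⇒∣p∣≤1 : ∀ {x : Fin n} {p : Subset n} → p ⊆ ⁅ x ⁆ → ∣ p ∣ ≤ 1
  p⊆⁅x⁆⇒∣p∣≤1 {x} {p} p⊆⁅x⁆ = subst (∣ p ∣ ≤_) (∣⁅x⁆∣≡1 x) (p⊆q⇒∣p∣≤∣q∣ p⊆⁅x⁆)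

  satisfying : {P : Pred (Fin n) 0ℓ} → Decidable P → Subset n
  satisfying P? = tabulate (does ∘ P?)

  module _ {P : Pred (Fin n) 0ℓ} (P? : Decidable P) where

    ∈-satisfying⁺ : ∀ {x} → P x → x ∈ satisfying P?
    ∈-satisfying⁺ {x} px = lookup⇒[]= x _ (trans (lookup∘tabulate _ x) (dec-true (P? x) px))

    ∈-satisfying⁻ : ∀ {x} → x ∈ satisfying P? → P x
    ∈-satisfying⁻ {x} x∈
      with P? x | trans (sym ([]=⇒lookup x∈)) (lookup∘tabulate (does ∘ P?) x)
    ... | yes px | _  = px
    ... | no  _  | ()

  shrinking⇒Empty : (S : ℕ → Subset n) →
                    (∀ k → Nonempty (S (suc k)) → ∣ S (suc k) ∣ < ∣ S k ∣) → Empty (S n)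
  shrinking⇒Empty S shrinks (x , x∈Sn) =
    n≮n n (<-≤-trans (m<m+n n (x∈p⇒0<∣p∣ x∈Sn)) (bound n (x , x∈Sn)))
    where
    bound : ∀ k → Nonempty (S k) → k + ∣ S k ∣ ≤ n
    bound zero    _        = ∣p∣≤n (S zero)
    bound (suc k) Sk+1≢∅ = begin
      suc k + ∣ S (suc k) ∣ ≡⟨ sym (+-suc k _) ⟩
      k + suc ∣ S (suc k) ∣ ≤⟨ +-monoʳ-≤ k shrink ⟩
      k + ∣ S k ∣           ≤⟨ bound k Sk≢∅ ⟩
      n                     ∎
      where
      open ≤-Reasoning
      shrink = shrinks k Sk+1≢∅
      Sk≢∅ = 0<∣p∣⇒Nonempty (≤-<-trans z≤n shrink)

module _ {n : ℕ} (H : Hypergraph n) {U : Subset n} where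

  ∈-induced⁺ : ∀ {h} → h List.∈ E H → Nonempty (h ∩ U) → h ∩ U List.∈ E (induced H U)
  ∈-induced⁺ h∈ h∩U≢∅ = ∈-filter⁺ nonempty? (∈-map⁺ (_∩ U) h∈) h∩U≢∅

  ∈-induced⁻ : ∀ {e} → e List.∈ E (induced H U) →
               Nonempty e × ∃ λ h → h List.∈ E H × e ≡ h ∩ U
  ∈-induced⁻ e∈ with e∈map , e≢∅ ← ∈-filter⁻ nonempty? e∈ = e≢∅ , ∈-map⁻ (_∩ U) e∈map

-- Degeneracy without reference to the core: no nonempty U ⊆ V(H) spans a
-- subhypergraph whose hyperedges all have at least two vertices.
Coreless : ∀ {n} → Hypergraph n → Set
Coreless H = ∀ U → U ⊆ V H → AllEdgesAtLeast2 (induced H U) → Empty U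

Degenerate⇔Coreless : ∀ {n} (H : Hypergraph n) → Degenerate H ⇔ Coreless H
Degenerate⇔Coreless H = mk⇔ to from
  where
  to : Degenerate H → Coreless H
  to (C , (_ , _ , maximal) , C≡∅) U U⊆V U-big (x , x∈U) = C≡∅ (x , maximal U U⊆V U-big x∈U)

  ⊥-big : AllEdgesAtLeast2 (induced H ⊥)
  ⊥-big = All.tabulate λ e∈ →
    let (x , x∈e) , _ , _ , e≡h∩⊥ = ∈-induced⁻ H e∈
    in ⊥-elim (∉⊥ (proj₂ (x∈p∩q⁻ _ ⊥ (subst (x ∈_) e≡h∩⊥ x∈e))))

  from : Coreless H → Degenerate H
  from coreless = ⊥ , (⊆-min (V H) , ⊥-big , maximal) , λ (_ , x∈⊥) → ∉⊥ x∈⊥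
    where
    maximal : ∀ U → U ⊆ V H → AllEdgesAtLeast2 (induced H U) → U ⊆ ⊥
    maximal U U⊆V U-big x∈U = ⊥-elim (coreless U U⊆V U-big (_ , x∈U))

module _ {n : ℕ} (H : Hypergraph n) (B : Subset n) where

  burned? : ∀ k → Decidable (Burned H B k)
  burned? zero    v = v ∈? B
  burned? (suc k) v = burned? k v ⊎-dec
    map′ (λ any → let h , h∈ , p = List.find any in h , h∈ , p)
         (λ (_ , h∈ , p) → List.lose h∈ p)
         (any? (λ h → (v ∈? h) ×-dec all? (λ w → (w ∈? h) →-dec (¬? (w ≟ v) →-dec burned? k w)))
               (E H))

  ∈B⇒Burned : ∀ k {v} → v ∈ B → Burned H B k v
  ∈B⇒Burned zero    v∈B = v∈B
  ∈B⇒Burned (suc k) v∈B = inj₁ (∈B⇒Burned k v∈B)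

  never-Burned : ∀ {U} → U ⊆ V H ─ B → AllEdgesAtLeast2 (induced (H ∖ B) U) →
                 ∀ k {v} → v ∈ U → ¬ Burned H B k v
  never-Burned U⊆V─B _ zero v∈U v∈B = x∈p─q⇒x∉q (V H) B (U⊆V─B v∈U) v∈B
  never-Burned U⊆V─B U-big (suc k) v∈U (inj₁ burned) = never-Burned U⊆V─B U-big k v∈U burned
  never-Burned {U} U⊆V─B U-big (suc k) {v} v∈U (inj₂ (h , h∈ , v∈h , others-burned)) =
    <⇒≱ (All.lookup U-big e∈) (p⊆⁅x⁆⇒∣p∣≤1 e⊆⁅v⁆)
    where
    e∈ : (h ∩ (V H ─ B)) ∩ U List.∈ E (induced (H ∖ B) U)
    e∈ = ∈-induced⁺ (H ∖ B) (∈-induced⁺ H h∈ (v , x∈p∩q⁺ (v∈h , U⊆V─B v∈U)))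
                   (v , x∈p∩q⁺ (x∈p∩q⁺ (v∈h , U⊆V─B v∈U) , v∈U))

    e⊆⁅v⁆ : (h ∩ (V H ─ B)) ∩ U ⊆ ⁅ v ⁆
    e⊆⁅v⁆ {w} w∈e with w ≟ v
    ... | yes refl = x∈⁅x⁆ v
    ... | no  w≢v  = ⊥-elim (never-Burned U⊆V─B U-big k w∈U (others-burned w w∈h w≢v))
      where
      w∈U = proj₂ (x∈p∩q⁻ _ U w∈e)
      w∈h = proj₁ (x∈p∩q⁻ h _ (proj₁ (x∈p∩q⁻ _ U w∈e)))

  IsLazyBurningSet⇒Coreless : IsLazyBurningSet H B → Coreless (H ∖ B)
  IsLazyBurningSet⇒Coreless (k , all-burned) U U⊆V─B U-big (v , v∈U) =
    never-Burned U⊆V─B U-big k v∈U (all-burned v (p─q⊆p (V H) B (U⊆V─B v∈U)))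

  Unburned : ℕ → Pred (Fin n) 0ℓ
  Unburned k v = v ∈ V H × ¬ Burned H B k v

  unburned? : ∀ k → Decidable (Unburned k)
  unburned? k v = (v ∈? V H) ×-dec ¬? (burned? k v)

  unburned : ℕ → Subset n
  unburned k = satisfying (unburned? k)

  unburned⊆V─B : ∀ k → unburned k ⊆ V H ─ B
  unburned⊆V─B k v∈ with v∈V , unburnt ← ∈-satisfying⁻ (unburned? k) v∈ =
    x∈p∧x∉q⇒x∈p─q v∈V (unburnt ∘ ∈B⇒Burned k)

  unburned-suc⊆ : ∀ k → unburned (suc k) ⊆ unburned k
  unburned-suc⊆ k v∈ with v∈V , unburnt ← ∈-satisfying⁻ (unburned? (suc k)) v∈ =
    ∈-satisfying⁺ (unburned? k) (v∈V , unburnt ∘ inj₁)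

  module _ (wf : WellFormed H) where

    singleton-edge-burns : ∀ {k e} → e List.∈ E (induced (H ∖ B) (unburned k)) →
                           ¬ 2 ≤ ∣ e ∣ →
                           ∃ λ v → v ∈ unburned k × Burned H B (suc k) v
    singleton-edge-burns {k} e∈ e-small
      with (v , v∈e) , g , g∈ , refl ← ∈-induced⁻ (H ∖ B) e∈
      with _ , h , h∈ , refl ← ∈-induced⁻ H g∈
      with v∈h∩W , v∈unburned ← x∈p∩q⁻ _ _ v∈e
      with v∈h , _ ← x∈p∩q⁻ h _ v∈h∩W
      = v , v∈unburned , inj₂ (h , h∈ , v∈h , others-burned)
      where
      others-burned : ∀ w → w ∈ h → w ≢ v → Burned H B k w
      others-burned w w∈h w≢v = decidable-stable (burned? k w) λ unburnt →
        let w∈unburned = ∈-satisfying⁺ (unburned? k) (proj₂ (All.lookup wf h∈) w∈h , unburnt)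
            w∈e = x∈p∩q⁺ (x∈p∩q⁺ (w∈h , unburned⊆V─B k w∈unburned) , w∈unburned)
        in e-small (x∈p∧y∈p∧x≢y⇒2≤∣p∣ w∈e v∈e w≢v)

    module _ (coreless : Coreless (H ∖ B)) where

      unburned-progress : ∀ k → Nonempty (unburned k) →
                          ∃ λ v → v ∈ unburned k × Burned H B (suc k) v
      unburned-progress k unburned≢∅ =
        let e , e∈ , e-small = List.find (¬All⇒Any¬ (λ e → 2 ≤? ∣ e ∣) _ unburned-small)
        in singleton-edge-burns e∈ e-small
        where
        unburned-small : ¬ AllEdgesAtLeast2 (induced (H ∖ B) (unburned k))
        unburned-small big = coreless (unburned k) (unburned⊆V─B k) big unburned≢∅

      unburned-shrinks : ∀ k → Nonempty (unburned (suc k)) →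
                         ∣ unburned (suc k) ∣ < ∣ unburned k ∣
      unburned-shrinks k (x , x∈)
        with v , v∈unburned , v-burns ← unburned-progress k (x , unburned-suc⊆ k x∈)
        = ≤-<-trans (p⊆q⇒∣p∣≤∣q∣ ⊆unburned-v) (x∈p⇒∣p-x∣<∣p∣ v∈unburned)
        where
        ⊆unburned-v : unburned (suc k) ⊆ unburned k - v
        ⊆unburned-v w∈ = x∈p∧x≢y⇒x∈p-y (unburned-suc⊆ k w∈)
          λ { refl → proj₂ (∈-satisfying⁻ (unburned? (suc k)) w∈) v-burns }

      Coreless⇒IsLazyBurningSet : IsLazyBurningSet H B
      Coreless⇒IsLazyBurningSet = n , λ v v∈V → decidable-stable (burned? n v) λ unburnt →
        shrinking⇒Empty unburned unburned-shrinks (v , ∈-satisfying⁺ (unburned? n) (v∈V , unburnt))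

theorem3p5 : ∀ {n : ℕ} (H : Hypergraph n) (B : Subset n) →
    WellFormed H → B ⊆ V H →
    (IsLazyBurningSet H B ⇔ Degenerate (H ∖ B))
theorem3p5 H B wf _ =
  ⇔.trans (mk⇔ (IsLazyBurningSet⇒Coreless H B) (Coreless⇒IsLazyBurningSet H B wf))
          (⇔.sym (Degenerate⇔Coreless (H ∖ B)))
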